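{- Let $A=\{a_1<a_2<\dots\}$ and $B=\{b_1<b_2<\dots\}$ be infinite subsets of $\mathbb N=\{0,1,2,\dots\}$, enumerated in increasing order. For $k\geqslant 1$ let $A(k)=\{a_1,\dots,a_k\}$, $u(k)=s(A(k))$, $d(k)=\max\{|a_i-b_i| : i\leqslant k\}$, and define $$w(A,B)=\sup_{k\geqslant 1}\frac{u(k)}{4d(k)+1}.$$ If $w(A,B)=\infty$, then $s(A)=\infty$ and $s(B)=\infty$ (i.e., $A$ and $B$ are both in the upper class).
   Context: For $X\subseteq \mathbb N$ and $n\in\mathbb N$, $r(X,n)$ denotes the number of ordered pairs $(x,y)\in X\times X$ with $x+y=n$, and $s(X)=\sup\{r(X,n): n\in\mathbb N\}\in\mathbb N\cup\{\infty\}$. A set $X$ is said to be in the upper class if $s(X)=\infty$, and in the lower class otherwise. -}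

module Defs where

open import Data.Bool using (Bool; true; false; _∧_; if_then_else_)
open import Data.Nat using (ℕ; zero; suc; _+_; _*_; _∸_; _≤_; _<_; _⊔_; ∣_-_∣; _≡ᵇ_)
open import Data.List using (List; upTo; map; foldr; filterᵇ; length)
open import Data.Bool.ListAction using (any)
open import Data.Product using (∃; _×_)
open import Relation.Binary.PropositionalEquality using (_≡_)

SubsetN : Set
SubsetN = ℕ → Bool

-- Enumerations: an infinite subset {a₁ < a₂ < …} of ℕ is given by a
-- strictly increasing sequence a : ℕ → ℕ, with a 0 = a₁, a 1 = a₂, ….
StrictlyIncreasing : (ℕ → ℕ) → Set
StrictlyIncreasing a = ∀ i → a i < a (suc i)

-- The set {a i : i < k}  (i.e. {a₁,…,a_k}).
initSeg : (ℕ → ℕ) → ℕ → SubsetN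
initSeg a k x = any (λ i → a i ≡ᵇ x) (upTo k)

-- The range of a strictly increasing sequence: since a i ≥ i, x is in the
-- range iff x = a i for some i ≤ x.
range : (ℕ → ℕ) → SubsetN
range a x = initSeg a (suc x) x

-- r(X,n): number of ordered pairs (x,y) ∈ X × X with x + y = n
-- (each such pair is determined by x ∈ {0,…,n}, with y = n ∸ x).
r : SubsetN → ℕ → ℕ
r X n = length (filterᵇ (λ x → X x ∧ X (n ∸ x)) (upTo (suc n)))

maxR : SubsetN → ℕ → ℕ
maxR X N = foldr (λ n m → r X n ⊔ m) 0 (upTo (suc N))

-- Upper class: s(X) = ∞, i.e. r(X,·) is unbounded.
UpperClass : SubsetN → Set
UpperClass X = ∀ m → ∃ λ n → m ≤ r X n

-- u(k) = s(A(k)) for k ≥ 1.  A(k) ⊆ {0,…,a_k}, so r(A(k),n) = 0 for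
-- n > 2 a_k, hence s(A(k)) = max_{n ≤ 2 a_k} r(A(k),n).
-- Here a_k = a (k ∸ 1).
u : (ℕ → ℕ) → ℕ → ℕ
u a k = maxR (initSeg a k) (2 * a (k ∸ 1))

-- d(k) = max { |a_i - b_i| : i ≤ k } = max { ∣ a i - b i ∣ : i < k } (0-indexed).
d : (ℕ → ℕ) → (ℕ → ℕ) → ℕ → ℕ
d a b k = foldr (λ i m → ∣ a i - b i ∣ ⊔ m) 0 (upTo k)

-- w(A,B) = sup_{k ≥ 1} u(k)/(4d(k)+1) = ∞ : for every M there is k ≥ 1 with
-- u(k)/(4d(k)+1) > M.
WInfinite : (ℕ → ℕ) → (ℕ → ℕ) → Set
WInfinite a b = ∀ M → ∃ λ k → 1 ≤ k × M * (4 * d a b k + 1) < u a k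

module Submission where

-- For A this is immediate: u(k) exceeds any prescribed M, so some n has more
-- than M representations by A(k) ⊆ A.  For B we transfer representations along
-- the partner map φ : a i ↦ b i (i < k), which moves every element of A(k) by
-- at most D = d(k).  Suppose n₀ has more than M(4D+1) representations
-- n₀ = x + y with x, y ∈ A(k).  The partner sums φ x + φ y all lie in a window
-- of 4D+1 consecutive integers around n₀, so by the pigeonhole principle some
-- value w is attained by more than M of them; since φ is injective, these give
-- more than M distinct representations of w by B.

open import Defs
open import Data.Bool using (Bool; T; true; false; _∧_)
open import Data.Bool.Properties using (T-∧)
open import Data.Empty using (⊥-elim)
open import Data.Fin using (Fin)
open import Data.Fin.Properties using (injective⇒≤)
open import Data.List using (List; []; _∷_; length; lookup; filter; filterᵇ; upTo; foldr)
open import Data.List.Membership.Propositional using (_∈_; find; lose)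
open import Data.List.Membership.Propositional.Properties
  using (∈-lookup; ∈-filter⁺; ∈-filter⁻; ∈-upTo⁺; ∈-upTo⁻)
open import Data.List.Relation.Unary.All as All using (All; []; _∷_)
open import Data.List.Relation.Unary.Any using (here; there; index)
open import Data.List.Relation.Unary.Any.Properties using (lookup-index; any⁺; any⁻)
open import Data.List.Relation.Unary.Unique.Propositional using (Unique)
open import Data.List.Relation.Unary.AllPairs using (_∷_)
open import Data.List.Relation.Unary.Unique.Propositional.Properties
  using (upTo⁺) renaming (filter⁺ to Unique-filter⁺)
open import Data.List.Relation.Binary.Sublist.Propositional using (_⊆_; ⊆-refl)
open import Data.List.Relation.Binary.Sublist.Propositional.Properties
  using (filter-⊆; length-mono-≤) renaming (filter⁺ to Sublist-filter⁺)
open import Data.Nat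
  using (ℕ; zero; suc; _+_; _*_; _∸_; _≤_; _<_; _⊔_; ∣_-_∣; _≡ᵇ_; _≟_; _<?_; z≤n; s≤s; s≤s⁻¹)
open import Data.Nat.Properties
open import Data.Product using (∃; _×_; _,_; proj₁; proj₂; map₁)
open import Data.Sum using (inj₁; inj₂)
open import Function using (id; _∘_)
open import Function.Bundles using (Equivalence)
open import Level using (0ℓ)
open import Relation.Nullary using (yes; no; does; contradiction)
open import Relation.Nullary.Decidable using (T?)
open import Relation.Unary using (Pred; Decidable)
open import Relation.Unary.Properties using (∁?)
open import Relation.Binary.Definitions using (tri<; tri≈; tri>)
open import Relation.Binary.PropositionalEquality

module _ {A : Set} {P : Pred A 0ℓ} (P? : Decidable P) where

  length-filter-split : ∀ xs → length xs ≡ length (filter P? xs) + length (filter (∁? P?) xs)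
  length-filter-split []       = refl
  length-filter-split (x ∷ xs) with does (P? x)
  ... | true  = cong suc (length-filter-split xs)
  ... | false = trans (cong suc (length-filter-split xs)) (sym (+-suc _ _))

length-filter-mono : ∀ {A : Set} {P Q : Pred A 0ℓ} (P? : Decidable P) (Q? : Decidable Q)
  {xs ys : List A} → (∀ {x} → P x → Q x) → xs ⊆ ys →
  length (filter P? xs) ≤ length (filter Q? ys)
length-filter-mono P? Q? P⇒Q xs⊆ys =
  length-mono-≤ (Sublist-filter⁺ P? Q? (λ { refl → P⇒Q }) xs⊆ys)

-- Pigeonhole principle with multiplicities: if more than M·N entries of a list
-- take their g-values in the window [lo, lo + N), some value is taken more
-- than M times.  Induction on N, peeling off the top value lo + N.
pigeonhole : ∀ {A : Set} (g : A → ℕ) (M lo N : ℕ) (xs : List A) →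
  All (λ x → lo ≤ g x × g x < lo + N) xs → M * N < length xs →
  ∃ λ w → M < length (filter (λ x → g x ≟ w) xs)
pigeonhole g M lo zero [] _ overfull = contradiction overfull n≮0
pigeonhole g M lo zero (x ∷ _) ((lo≤gx , gx<lo+0) ∷ _) _ =
  contradiction (subst (g x <_) (+-identityʳ lo) gx<lo+0) (≤⇒≯ lo≤gx)
pigeonhole {A} g M lo (suc N) xs window overfull
  with M <? length (filter (λ x → g x ≟ lo + N) xs)
... | yes many = lo + N , many
... | no few   =
  let w , many = pigeonhole g M lo N rest narrower stillOverfull
  in  w , <-≤-trans many (length-filter-mono _ _ id (filter-⊆ _ xs))
  where
  rest : List A
  rest = filter (∁? (λ x → g x ≟ lo + N)) xs

  narrower : All (λ x → lo ≤ g x × g x < lo + N) rest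
  narrower = All.tabulate λ {x} x∈rest →
    let x∈xs , gx≢top = ∈-filter⁻ (∁? (λ x → g x ≟ lo + N)) x∈rest
        lo≤gx , gx<lo+1+N = All.lookup window x∈xs
    in  lo≤gx , ≤∧≢⇒< (s≤s⁻¹ (subst (g x <_) (+-suc lo N) gx<lo+1+N)) gx≢top

  stillOverfull : M * N < length rest
  stillOverfull = +-cancelˡ-< M (M * N) (length rest) (begin-strict
    M + M * N                                              ≡⟨ *-suc M N ⟨
    M * suc N                                              <⟨ overfull ⟩
    length xs                                              ≡⟨ length-filter-split _ xs ⟩
    length (filter (λ x → g x ≟ lo + N) xs) + length rest  ≤⟨ +-monoˡ-≤ (length rest) (≮⇒≥ few) ⟩
    M + length rest                                        ∎)
    where open ≤-Reasoning

lookup-injective : ∀ {A : Set} {xs : List A} → Unique xs →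
  ∀ {i j} → lookup xs i ≡ lookup xs j → i ≡ j
lookup-injective (_ ∷ _)        {Fin.zero}  {Fin.zero}  _  = refl
lookup-injective (x∉xs ∷ _)     {Fin.zero}  {Fin.suc j} eq = ⊥-elim (All.lookup x∉xs (∈-lookup j) eq)
lookup-injective (x∉xs ∷ _)     {Fin.suc i} {Fin.zero}  eq = ⊥-elim (All.lookup x∉xs (∈-lookup i) (sym eq))
lookup-injective (_ ∷ distinct) {Fin.suc i} {Fin.suc j} eq = cong Fin.suc (lookup-injective distinct eq)

injection⇒length≤ : ∀ {A B : Set} (h : A → B) {xs : List A} {ys : List B} → Unique xs →
  (∀ {x} → x ∈ xs → h x ∈ ys) →
  (∀ {x y} → x ∈ xs → y ∈ xs → h x ≡ h y → x ≡ y) →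
  length xs ≤ length ys
injection⇒length≤ h {xs} {ys} distinct mapsInto injectiveOn = injective⇒≤ {f = image} image-injective
  where
  image : Fin (length xs) → Fin (length ys)
  image i = index (mapsInto (∈-lookup i))

  image-correct : ∀ i → h (lookup xs i) ≡ lookup ys (image i)
  image-correct i = lookup-index (mapsInto (∈-lookup i))

  image-injective : ∀ {i j} → image i ≡ image j → i ≡ j
  image-injective {i} {j} eq = lookup-injective distinct
    (injectiveOn (∈-lookup i) (∈-lookup j)
      (trans (image-correct i) (trans (cong (lookup ys) eq) (sym (image-correct j)))))

foldr-⊔-upper : ∀ (f : ℕ → ℕ) {n} ns → n ∈ ns → f n ≤ foldr (λ i acc → f i ⊔ acc) 0 ns
foldr-⊔-upper f (n ∷ ns) (here refl) = m≤m⊔n (f n) _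
foldr-⊔-upper f (m ∷ ns) (there n∈) = m≤n⇒m≤o⊔n (f m) (foldr-⊔-upper f ns n∈)

foldr-⊔-attained : ∀ (f : ℕ → ℕ) {m} ns → m < foldr (λ i acc → f i ⊔ acc) 0 ns →
  ∃ λ n → m < f n
foldr-⊔-attained f (n ∷ ns) m<max with ⊔-sel (f n) (foldr (λ i acc → f i ⊔ acc) 0 ns)
... | inj₁ max≡fn   = n , subst (_ <_) max≡fn m<max
... | inj₂ max≡rest = foldr-⊔-attained f ns (subst (_ <_) max≡rest m<max)

module _ {a : ℕ → ℕ} (increasing : StrictlyIncreasing a) where

  increasing-< : ∀ {i j} → i < j → a i < a j
  increasing-< {i} {suc j} (s≤s i≤j) with m≤n⇒m<n∨m≡n i≤j
  ... | inj₁ i<j  = <-trans (increasing-< i<j) (increasing j)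
  ... | inj₂ refl = increasing i

  increasing-injective : ∀ {i j} → a i ≡ a j → i ≡ j
  increasing-injective {i} {j} eq with <-cmp i j
  ... | tri< i<j _ _ = contradiction eq (<⇒≢ (increasing-< i<j))
  ... | tri≈ _ i≡j _ = i≡j
  ... | tri> _ _ j<i = contradiction (sym eq) (<⇒≢ (increasing-< j<i))

  -- a i ≥ i, which is why range a may restrict its search to indices i ≤ x.
  index≤value : ∀ i → i ≤ a i
  index≤value zero    = z≤n
  index≤value (suc i) = ≤-trans (s≤s (index≤value i)) (increasing i)

initSeg⁻ : ∀ a k {x} → T (initSeg a k x) → ∃ λ i → i < k × a i ≡ x
initSeg⁻ a k {x} x∈A[k] =
  let i , i∈ , ai≡ᵇx = find (any⁻ (λ i → a i ≡ᵇ x) (upTo k) x∈A[k])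
  in  i , ∈-upTo⁻ i∈ , ≡ᵇ⇒≡ (a i) x ai≡ᵇx

initSeg⁺ : ∀ a {k i} → i < k → T (initSeg a k (a i))
initSeg⁺ a {i = i} i<k = any⁺ _ (lose (∈-upTo⁺ i<k) (≡⇒≡ᵇ (a i) (a i) refl))

-- Every a i belongs to A; this uses i ≤ a i.
range⁺ : ∀ {a} → StrictlyIncreasing a → ∀ i → T (range a (a i))
range⁺ {a} increasing i = initSeg⁺ a (s≤s (index≤value increasing i))

initSeg⊆range : ∀ {a} → StrictlyIncreasing a → ∀ k {x} → T (initSeg a k x) → T (range a x)
initSeg⊆range {a} increasing k x∈A[k] with initSeg⁻ a k x∈A[k]
... | i , _ , refl = range⁺ increasing i

represents : SubsetN → ℕ → ℕ → Bool
represents X n x = X x ∧ X (n ∸ x)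

representations : SubsetN → ℕ → List ℕ
representations X n = filterᵇ (represents X n) (upTo (suc n))

representation⁻ : ∀ X n {x} → x ∈ representations X n → x ≤ n × T (X x) × T (X (n ∸ x))
representation⁻ X n x∈ =
  let x∈upTo , both = ∈-filter⁻ (T? ∘ represents X n) {xs = upTo (suc n)} x∈
      x∈X , n∸x∈X   = Equivalence.to T-∧ both
  in  s≤s⁻¹ (∈-upTo⁻ x∈upTo) , x∈X , n∸x∈X

representation⁺ : ∀ X n {x} → x ≤ n → T (X x) → T (X (n ∸ x)) → x ∈ representations X n
representation⁺ X n x≤n x∈X n∸x∈X =
  ∈-filter⁺ (T? ∘ represents X n) (∈-upTo⁺ (s≤s x≤n)) (Equivalence.from T-∧ (x∈X , n∸x∈X))

representations-unique : ∀ X n → Unique (representations X n)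
representations-unique X n = Unique-filter⁺ (T? ∘ represents X n) (upTo⁺ (suc n))

r-mono : ∀ {X Y} n → (∀ {x} → T (X x) → T (Y x)) → r X n ≤ r Y n
r-mono {X} {Y} n X⊆Y = length-filter-mono (T? ∘ represents X n) (T? ∘ represents Y n)
  {xs = upTo (suc n)}
  (λ both → let x∈X , y∈X = Equivalence.to T-∧ both in Equivalence.from T-∧ (X⊆Y x∈X , X⊆Y y∈X))
  ⊆-refl

Near : ℕ → ℕ → ℕ → Set
Near D p q = p ≤ q + D × q ≤ p + D

∣-∣≤⇒Near : ∀ {D} p q → ∣ p - q ∣ ≤ D → Near D p q
∣-∣≤⇒Near {D} p q dist≤D = one-sided p q dist≤D , one-sided q p (subst (_≤ D) (∣-∣-comm p q) dist≤D)
  where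
  one-sided : ∀ p q → ∣ p - q ∣ ≤ D → p ≤ q + D
  one-sided p q dist≤D = ≤-trans (m≤n+m∸n p q) (+-monoʳ-≤ q (≤-trans (m∸n≤∣m-n∣ p q) dist≤D))

Near-+ : ∀ {D E p q p′ q′} → Near D p q → Near E p′ q′ → Near (D + E) (p + p′) (q + q′)
Near-+ {D} {E} {p} {q} {p′} {q′} (p≤ , q≤) (p′≤ , q′≤) =
  ≤-trans (+-mono-≤ p≤ p′≤) (≤-reflexive (regroup q q′ D E)) ,
  ≤-trans (+-mono-≤ q≤ q′≤) (≤-reflexive (regroup p p′ D E))
  where
  regroup : ∀ m n D E → (m + D) + (n + E) ≡ (m + n) + (D + E)
  regroup = solve-∀ where open import Data.Nat.Tactic.RingSolver

Near⇒window : ∀ D c s → Near (D + D) c s → c ∸ (D + D) ≤ s × s < c ∸ (D + D) + (4 * D + 1)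
Near⇒window D c s (c≤ , s≤) = m≤n+o⇒m∸n≤o c (D + D) (subst (c ≤_) (+-comm s (D + D)) c≤) , s<
  where
  open ≤-Reasoning
  lo = c ∸ (D + D)
  s< : s < lo + (4 * D + 1)
  s< = begin-strict
    s                          ≤⟨ s≤ ⟩
    c + (D + D)                ≤⟨ +-monoˡ-≤ (D + D) (m≤n+m∸n c (D + D)) ⟩
    ((D + D) + lo) + (D + D)   ≡⟨ regroup D lo ⟩
    lo + 4 * D                 <⟨ +-monoʳ-< lo (n<1+n (4 * D)) ⟩
    lo + suc (4 * D)           ≡⟨ cong (lo +_) (+-comm 1 (4 * D)) ⟩
    lo + (4 * D + 1)           ∎
    where
    regroup : ∀ D l → ((D + D) + l) + (D + D) ≡ l + 4 * D
    regroup = solve-∀ where open import Data.Nat.Tactic.RingSolver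

position : (ℕ → ℕ) → ℕ → ℕ → ℕ
position a zero    x = 0
position a (suc k) x with a k ≟ x
... | yes _ = k
... | no  _ = position a k x

position-correct : ∀ a k {i x} → i < k → a i ≡ x → position a k x < k × a (position a k x) ≡ x
position-correct a (suc k) {i} {x} i<1+k ai≡x with a k ≟ x
... | yes ak≡x = n<1+n k , ak≡x
... | no  ak≢x with m≤n⇒m<n∨m≡n (s≤s⁻¹ i<1+k)
...   | inj₁ i<k  = map₁ m<n⇒m<1+n (position-correct a k i<k ai≡x)
...   | inj₂ refl = contradiction ai≡x ak≢x

partner : (a b : ℕ → ℕ) → ℕ → ℕ → ℕ
partner a b k x = b (position a k x)

-- Only B needs to be increasing here: it makes the partner map injective.
module Transfer (a : ℕ → ℕ) {b : ℕ → ℕ} (increasingB : StrictlyIncreasing b) (k : ℕ) where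

  X : SubsetN
  X = initSeg a k

  D : ℕ
  D = d a b k

  φ : ℕ → ℕ
  φ = partner a b k

  indexOf : ∀ {x} → T (X x) → position a k x < k × a (position a k x) ≡ x
  indexOf x∈X = let i , i<k , ai≡x = initSeg⁻ a k x∈X in position-correct a k i<k ai≡x

  φ-range : ∀ {x} → T (X x) → T (range b (φ x))
  φ-range {x} _ = range⁺ increasingB (position a k x)

  φ-near : ∀ {x} → T (X x) → Near D x (φ x)
  φ-near {x} x∈X = let i<k , ai≡x = indexOf x∈X in
    subst (λ y → Near D y (φ x)) ai≡x
      (∣-∣≤⇒Near _ _ (foldr-⊔-upper (λ i → ∣ a i - b i ∣) (upTo k) (∈-upTo⁺ i<k)))

  φ-injective : ∀ {x y} → T (X x) → T (X y) → φ x ≡ φ y → x ≡ y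
  φ-injective {x} {y} x∈X y∈X φx≡φy = begin
    x                      ≡⟨ proj₂ (indexOf x∈X) ⟨
    a (position a k x)     ≡⟨ cong a (increasing-injective increasingB φx≡φy) ⟩
    a (position a k y)     ≡⟨ proj₂ (indexOf y∈X) ⟩
    y                      ∎
    where open ≡-Reasoning

  partnerSum : ℕ → ℕ → ℕ
  partnerSum n₀ x = φ x + φ (n₀ ∸ x)

  partnerSum-window : ∀ n₀ {x} → x ∈ representations X n₀ →
    n₀ ∸ (D + D) ≤ partnerSum n₀ x × partnerSum n₀ x < n₀ ∸ (D + D) + (4 * D + 1)
  partnerSum-window n₀ {x} x∈ =
    let x≤n₀ , x∈X , y∈X = representation⁻ X n₀ x∈
    in  Near⇒window D n₀ (partnerSum n₀ x)
          (subst (λ c → Near (D + D) c (partnerSum n₀ x)) (m+[n∸m]≡n x≤n₀)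
            (Near-+ (φ-near x∈X) (φ-near y∈X)))

  transfer : ∀ n₀ w → length (filter (λ x → partnerSum n₀ x ≟ w) (representations X n₀))
                      ≤ r (range b) w
  transfer n₀ w = injection⇒length≤ φ
    (Unique-filter⁺ _ (representations-unique X n₀)) mapsInto injectiveOn
    where
    chosen : ∀ {x} → x ∈ filter (λ x → partnerSum n₀ x ≟ w) (representations X n₀) →
      partnerSum n₀ x ≡ w × T (X x) × T (X (n₀ ∸ x))
    chosen x∈ = let x∈reps , sum≡w = ∈-filter⁻ (λ x → partnerSum n₀ x ≟ w) x∈
                    _ , x∈X , y∈X   = representation⁻ X n₀ x∈reps
                in  sum≡w , x∈X , y∈X

    mapsInto : ∀ {x} → x ∈ filter (λ x → partnerSum n₀ x ≟ w) (representations X n₀) →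
      φ x ∈ representations (range b) w
    mapsInto {x} x∈ =
      let sum≡w , x∈X , y∈X = chosen x∈
          w∸φx≡φy = trans (cong (_∸ φ x) (sym sum≡w)) (m+n∸m≡n (φ x) (φ (n₀ ∸ x)))
      in  representation⁺ (range b) w (subst (φ x ≤_) sum≡w (m≤m+n (φ x) _))
            (φ-range x∈X) (subst (λ z → T (range b z)) (sym w∸φx≡φy) (φ-range y∈X))

    injectiveOn : ∀ {x y} → x ∈ filter (λ x → partnerSum n₀ x ≟ w) (representations X n₀) →
      y ∈ filter (λ x → partnerSum n₀ x ≟ w) (representations X n₀) → φ x ≡ φ y → x ≡ y
    injectiveOn x∈ y∈ = φ-injective (proj₁ (proj₂ (chosen x∈))) (proj₁ (proj₂ (chosen y∈)))

  concentration : ∀ M n₀ → M * (4 * D + 1) < r X n₀ → ∃ λ w → M < r (range b) w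
  concentration M n₀ overfull =
    let w , many = pigeonhole (partnerSum n₀) M (n₀ ∸ (D + D)) (4 * D + 1)
                     (representations X n₀) (All.tabulate (partnerSum-window n₀)) overfull
    in  w , <-≤-trans many (transfer n₀ w)

u-attained : ∀ a k {m} → m < u a k → ∃ λ n → m < r (initSeg a k) n
u-attained a k = foldr-⊔-attained (r (initSeg a k)) (upTo (suc (2 * a (k ∸ 1))))

mainTheorem2 : (a b : ℕ → ℕ) → StrictlyIncreasing a → StrictlyIncreasing b →
    WInfinite a b → UpperClass (range a) × UpperClass (range b)
mainTheorem2 a b increasingA increasingB wInfinite = upperA , upperB
  where
  upperA : UpperClass (range a)
  upperA M =
    let k , _ , M[4D+1]<u = wInfinite M
        M≤M[4D+1]        = subst (_≤ M * (4 * d a b k + 1)) (*-identityʳ M)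
                             (*-monoʳ-≤ M (m≤n+m 1 (4 * d a b k)))
        n , M<rA[k]       = u-attained a k (≤-<-trans M≤M[4D+1] M[4D+1]<u)
    in  n , <⇒≤ (<-≤-trans M<rA[k] (r-mono n (initSeg⊆range increasingA k)))

  upperB : UpperClass (range b)
  upperB M =
    let k , _ , M[4D+1]<u = wInfinite M
        n₀ , overfull     = u-attained a k M[4D+1]<u
        w , M<rB          = Transfer.concentration a increasingB k M n₀ overfull
    in  w , <⇒≤ M<rB
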